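{- For every integer $n\ge 2$ there exists a finite $T_0$-space (poset) $X$ with $|X|=n$ and $d(X)=n$.
   Context: The $2$-dimension $d(X)$ of a finite $T_0$-space (poset) $X$ is the minimum $n\in\mathbb{N}_0$ such that $X$ is homeomorphic to a subspace of $\mathfrak{S}^n$, where $\mathfrak{S}=\{0,1\}$ is the Sierpinski space with unique proper nonempty open set $\{0\}$; equivalently, the minimum $n$ such that $X$ embeds as a subposet of $\{0,1\}^n$ with the product order. -}

module Defs where

open import Data.Nat using (ℕ; _<_)
open import Data.Fin using (Fin)
open import Data.Bool using (Bool)
open import Data.Product using (Σ; _×_)
open import Relation.Nullary using (¬_)
open import Relation.Binary.PropositionalEquality using (_≡_)
open import Relation.Binary.Structures using (IsPartialOrder)
open import Function.Bundles using (_⇔_)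

-- The Sierpinski space 𝔖 = {0,1} with unique proper nonempty open set {0},
-- viewed as a poset via the specialization order: 0 ≤ 1 (false ≤ true).
_≤𝔖_ : Bool → Bool → Set
_≤𝔖_ = Data.Bool._≤_

Cube : ℕ → Set
Cube m = Fin m → Bool

_≤ᶜ_ : {m : ℕ} → Cube m → Cube m → Set
_≤ᶜ_ {m} u v = (i : Fin m) → u i ≤𝔖 v i

-- A finite T₀-space (= finite poset) with n points, carrier Fin n.
record FinPoset (n : ℕ) : Set₁ where
  field
    _≤_       : Fin n → Fin n → Set
    isPartialOrder : IsPartialOrder _≡_ _≤_

-- X embeds as a subposet of {0,1}^m (equivalently, X is homeomorphic
-- to a subspace of 𝔖^m): an order embedding f (x ≤ y ⇔ f x ≤ f y),
-- which is additionally required to be injective.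
EmbedsIn : {n : ℕ} → FinPoset n → ℕ → Set
EmbedsIn {n} X m =
  Σ (Fin n → Cube m) λ f →
    ((x y : Fin n) → f x ≡ f y → x ≡ y) ×
    ((x y : Fin n) → (FinPoset._≤_ X x y ⇔ (f x ≤ᶜ f y)))

TwoDim≡ : {n : ℕ} → FinPoset n → ℕ → Set
TwoDim≡ X k = EmbedsIn X k × ((m : ℕ) → m < k → ¬ EmbedsIn X m)

{-# OPTIONS --safe #-}
-- Take X to be a chain of n − 1 points together with one isolated point.
-- Any finite poset embeds into {0,1}^|X| by sending x to the indicator of its
-- principal down-set, so d(X) ≤ n. Conversely, numbering X so that the chain
-- is 1 < 2 < ⋯ < n − 1 and 0 is isolated, the n pairs (j, j − 1 mod n) are
-- incomparable, and any two of them cross: for j < j′ one has j ≤ j′ − 1 or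
-- j′ ≤ j − 1 (mod n). An embedding must separate each pair (j, h) in a
-- coordinate where j is 1 and h is 0, and two crossing pairs cannot be
-- separated in the same coordinate, so at least n coordinates are needed.
module Submission where

open import Defs
open import Data.Nat as ℕ using (ℕ; _≤_; _<_; suc; z≤n; s≤s)
open import Data.Product using (Σ; ∃; _×_; _,_; proj₁; proj₂)
open import Level using (Level; _⊔_; 0ℓ)
import Data.Nat.Properties as ℕ
open import Data.Fin as F using (Fin; zero; suc; fromℕ; inject₁; toℕ)
import Data.Fin.Properties as F
open import Data.Bool as B using (Bool; true; false; b≤b; f≤t)
import Data.Bool.Properties as B
open import Data.Sum using (_⊎_; inj₁; inj₂; [_,_]′)
open import Relation.Nullary using (Dec; yes; no; does; ¬_; contradiction)
open import Relation.Nullary.Decidable using (map′)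
open import Relation.Binary using (Rel; Decidable)
open import Relation.Binary.PropositionalEquality as ≡
  using (_≡_; refl; sym; trans; cong; subst; subst₂)
open import Relation.Binary.Structures using (IsPartialOrder)
open import Function using (_∘_)
open import Function.Bundles using (_⇔_; mk⇔; Equivalence)

private
  variable
    a ℓ : Level
    m n : ℕ
    P Q : Set

does-monotone : (p : Dec P) (q : Dec Q) → (P → Q) → does p B.≤ does q
does-monotone (yes p) (yes q) P⇒Q = b≤b
does-monotone (yes p) (no ¬q) P⇒Q = contradiction (P⇒Q p) ¬q
does-monotone (no ¬p) (yes q) P⇒Q = f≤t
does-monotone (no ¬p) (no ¬q) P⇒Q = b≤b

does-reflects : (p : Dec P) (q : Dec Q) → does p B.≤ does q → P → Q
does-reflects (yes p) (yes q) _ _ = q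
does-reflects (no ¬p) _       _ p = contradiction p ¬p

≰⇒true-false : {x y : Bool} → ¬ x B.≤ y → x ≡ true × y ≡ false
≰⇒true-false {false} x≰y = contradiction (B.≤-minimum _) x≰y
≰⇒true-false {true} {false} x≰y = refl , refl
≰⇒true-false {true} {true} x≰y = contradiction b≤b x≰y

≤ᶜ-reflexive : {u v : Cube m} → u ≡ v → u ≤ᶜ v
≤ᶜ-reflexive {u = u} refl i = B.≤-refl {u i}

separatingCoordinate : {u v : Cube m} → ¬ u ≤ᶜ v → ∃ λ i → u i ≡ true × v i ≡ false
separatingCoordinate {m} {u} {v} u≰v =
  let i , uᵢ≰vᵢ = F.¬∀⟶∃¬ m (λ i → u i B.≤ v i) (λ i → u i B.≤? v i) u≰v
  in i , ≰⇒true-false uᵢ≰vᵢ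

module _ (X : FinPoset n) (_≤?_ : Decidable (FinPoset._≤_ X)) where
  open FinPoset X renaming (_≤_ to _≤ₓ_)
  open IsPartialOrder isPartialOrder using (antisym)
    renaming (refl to ≤-refl; trans to ≤-trans)

  principalDownset : Fin n → Cube n
  principalDownset x i = does (i ≤? x)

  principalDownset-⇔ : ∀ x y → x ≤ₓ y ⇔ principalDownset x ≤ᶜ principalDownset y
  principalDownset-⇔ x y = mk⇔
    (λ x≤y i → does-monotone (i ≤? x) (i ≤? y) (λ i≤x → ≤-trans i≤x x≤y))
    (λ ↓x≤↓y → does-reflects (x ≤? x) (x ≤? y) (↓x≤↓y x) ≤-refl)

  embedsIn-size : EmbedsIn X n
  embedsIn-size = principalDownset , injective , principalDownset-⇔
    where
    reflect : ∀ x y → principalDownset x ≡ principalDownset y → x ≤ₓ y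
    reflect x y ↓x≡↓y = Equivalence.from (principalDownset-⇔ x y) (≤ᶜ-reflexive ↓x≡↓y)

    injective : ∀ x y → principalDownset x ≡ principalDownset y → x ≡ y
    injective x y ↓x≡↓y = antisym (reflect x y ↓x≡↓y) (reflect y x (sym ↓x≡↓y))

record CrossingFamily {A : Set a} (_≲_ : Rel A ℓ) (n : ℕ) : Set (a ⊔ ℓ) where
  field
    lo hi     : Fin n → A
    unrelated : ∀ i → ¬ lo i ≲ hi i
    crossing  : ∀ {i j} → i F.< j → lo i ≲ hi j ⊎ lo j ≲ hi i

module _ {A : Set a} {_≲_ : Rel A ℓ} (family : CrossingFamily _≲_ n)
         (f : A → Cube m)
         (f-mono : ∀ {x y} → x ≲ y → f x ≤ᶜ f y)
         (f-reflects : ∀ {x y} → f x ≤ᶜ f y → x ≲ y) where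
  open CrossingFamily family

  private
    separation : ∀ i → ∃ λ c → f (lo i) c ≡ true × f (hi i) c ≡ false
    separation i = separatingCoordinate (unrelated i ∘ f-reflects)

    separator : Fin n → Fin m
    separator i = proj₁ (separation i)

    sharedSeparator⇒unrelated : ∀ i j → separator i ≡ separator j → ¬ lo i ≲ hi j
    sharedSeparator⇒unrelated i j eq loᵢ≲hiⱼ =
      true≰false (subst₂ B._≤_ loᵢ-true hiⱼ-false (f-mono loᵢ≲hiⱼ (separator j)))
      where
      loᵢ-true : f (lo i) (separator j) ≡ true
      loᵢ-true = trans (cong (f (lo i)) (sym eq)) (proj₁ (proj₂ (separation i)))

      hiⱼ-false : f (hi j) (separator j) ≡ false
      hiⱼ-false = proj₂ (proj₂ (separation j))

      true≰false : ¬ true B.≤ false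
      true≰false ()

  crossingFamily-≤ : n ≤ m
  crossingFamily-≤ = ℕ.≮⇒≥ λ m<n →
    let i , j , i<j , eq = F.pigeonhole m<n separator in
    [ sharedSeparator⇒unrelated i j eq , sharedSeparator⇒unrelated j i (sym eq) ]′ (crossing i<j)

embedsIn⇒crossingFamily-≤ : (X : FinPoset n) → CrossingFamily (FinPoset._≤_ X) m →
                             ∀ {d} → EmbedsIn X d → m ≤ d
embedsIn⇒crossingFamily-≤ X family (f , _ , f-⇔) =
  crossingFamily-≤ family f (Equivalence.to (f-⇔ _ _)) (Equivalence.from (f-⇔ _ _))

data _⊑_ {k : ℕ} : Rel (Fin (suc k)) 0ℓ where
  isolated : zero ⊑ zero
  chain    : {i j : Fin k} → i F.≤ j → suc i ⊑ suc j

_⊑?_ : Decidable (_⊑_ {n})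
zero  ⊑? zero  = yes isolated
zero  ⊑? suc j = no λ ()
suc i ⊑? zero  = no λ ()
suc i ⊑? suc j = map′ chain (λ { (chain i≤j) → i≤j }) (i F.≤? j)

⊑-isPartialOrder : IsPartialOrder _≡_ (_⊑_ {n})
⊑-isPartialOrder = record
  { isPreorder = record
    { isEquivalence = ≡.isEquivalence
    ; reflexive     = λ { {zero} refl → isolated ; {suc i} refl → chain F.≤-refl }
    ; trans         = λ { isolated isolated → isolated
                        ; (chain i≤j) (chain j≤k) → chain (F.≤-trans i≤j j≤k) }
    }
  ; antisym = λ { isolated isolated → refl
                ; (chain i≤j) (chain j≤i) → cong suc (F.≤-antisym i≤j j≤i) }
  }

PointAndChain : (k : ℕ) → FinPoset (suc k)
PointAndChain k = record { _≤_ = _⊑_ ; isPartialOrder = ⊑-isPartialOrder }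

cyclicPred : Fin (suc n) → Fin (suc n)
cyclicPred zero    = fromℕ _
cyclicPred (suc i) = inject₁ i

suc≰inject₁ : (i : Fin n) → ¬ suc i F.≤ inject₁ i
suc≰inject₁ i 1+i≤i = ℕ.n≮n (toℕ i) (subst (suc (toℕ i) ℕ.≤_) (F.toℕ-inject₁ i) 1+i≤i)

<suc⇒≤inject₁ : {i : Fin (suc n)} {j : Fin n} → i F.< suc j → i F.≤ inject₁ j
<suc⇒≤inject₁ {j = j} i<1+j = subst (_ ℕ.≤_) (sym (F.toℕ-inject₁ j)) (ℕ.s≤s⁻¹ i<1+j)

cyclicPred-crossing : (l : ℕ) → CrossingFamily (_⊑_ {suc l}) (suc (suc l))
cyclicPred-crossing l = record
  { lo = λ i → i ; hi = cyclicPred ; unrelated = unrelated ; crossing = crossing }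
  where
  unrelated : ∀ i → ¬ i ⊑ cyclicPred i
  unrelated zero          ()
  unrelated (suc zero)    ()
  unrelated (suc (suc i)) (chain 1+i≤i) = suc≰inject₁ i 1+i≤i

  crossing : ∀ {i j} → i F.< j → i ⊑ cyclicPred j ⊎ j ⊑ cyclicPred i
  crossing {zero}  {suc j}       _   = inj₂ (chain (F.≤fromℕ j))
  crossing {suc i} {suc zero}    (s≤s ())
  crossing {suc i} {suc (suc j)} i<j = inj₁ (chain (<suc⇒≤inject₁ (ℕ.s≤s⁻¹ i<j)))

mainTheorem5 : (n : ℕ) → 2 ≤ n → Σ (FinPoset n) λ X → TwoDim≡ X n
mainTheorem5 (suc (suc l)) (s≤s (s≤s z≤n)) =
  PointAndChain (suc l) , embedsIn-size (PointAndChain (suc l)) _⊑?_ , noSmallerEmbedding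
  where
  noSmallerEmbedding : ∀ m → m < suc (suc l) → ¬ EmbedsIn (PointAndChain (suc l)) m
  noSmallerEmbedding m m<n embedding =
    ℕ.<⇒≱ m<n (embedsIn⇒crossingFamily-≤ (PointAndChain (suc l)) (cyclicPred-crossing l) embedding)
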